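{- Let $m \geq 2$ be an integer and let $D$ be a weakly connected digraph such that the $m$-step competition graph $C^m(D)$ is triangle-free and the number of sources of $D$ equals the number of components of $C^m(D)$. Then for each source $v$ of $D$ and each vertex $u$ sharing a common prey with $v$ in $D$, $u$ has exactly one prey in $D$ and $v$ is the only vertex adjacent to $u$ in $C^m(D)$.
   Context: All digraphs are finite, may have loops, and (standing assumption) every vertex has outdegree at least $1$. For a positive integer $m$, a vertex $y$ is an $m$-step prey of $x$ (and $x$ an $m$-step predator of $y$) if there is a directed walk of length $m$ from $x$ to $y$; $1$-step prey/predators are called prey/predators. The $m$-step competition graph $C^m(D)$ has vertex set $V(D)$ and an edge between distinct vertices $x,y$ iff they have a common $m$-step prey. A source is a vertex of indegree $0$. $D$ is weakly connected if its underlying undirected graph is connected. -}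

module Defs where

open import Data.Nat using (ℕ; zero; suc)
open import Data.Bool using (Bool; true; false)
import Data.Bool.Properties as BoolP
open import Data.Fin using (Fin)
open import Data.Fin.Properties using (all?)
open import Data.List using (List; length; filter)
open import Data.Product using (Σ; ∃; _×_; _,_)
open import Data.Sum using (_⊎_)
open import Function using (_⇔_)
open import Function.Definitions using (Surjective)
open import Relation.Nullary using (¬_; Dec)
open import Relation.Unary using (Decidable)
open import Relation.Binary.PropositionalEquality using (_≡_; _≢_)
open import Relation.Binary.Construct.Closure.ReflexiveTransitive using (Star)
import Data.List as L
open import Data.Empty using (⊥)

-- A finite digraph on vertex set Fin n, given by its adjacency matrix
-- (loops allowed): Arc x y ≡ true means there is an arc x → y.
Digraph : ℕ → Set
Digraph n = Fin n → Fin n → Bool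

module _ {n : ℕ} (D : Digraph n) where

  -- y is a prey of x (x is a predator of y)
  Prey : Fin n → Fin n → Set
  Prey x y = D x y ≡ true

  -- standing assumption: every vertex has outdegree at least 1
  OutdegreePositive : Set
  OutdegreePositive = ∀ x → ∃ λ y → Prey x y

  Walk : ℕ → Fin n → Fin n → Set
  Walk zero x y = x ≡ y
  Walk (suc m) x y = ∃ λ z → Prey x z × Walk m z y

  StepPrey : ℕ → Fin n → Fin n → Set
  StepPrey m x y = Walk m x y

  Source : Fin n → Set
  Source x = ∀ y → D y x ≡ false

  Source? : Decidable Source
  Source? x = all? (λ y → D y x BoolP.≟ false)

  numSources : ℕ
  numSources = length (filter Source? (L.allFin n))

  UAdj : Fin n → Fin n → Set
  UAdj x y = Prey x y ⊎ Prey y x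

  WeaklyConnected : Set
  WeaklyConnected = ∀ x y → Star UAdj x y

  CompEdge : ℕ → Fin n → Fin n → Set
  CompEdge m x y = x ≢ y × ∃ λ z → StepPrey m x z × StepPrey m y z

-- Simple graphs on Fin n given by an (irreflexive, symmetric) edge relation
module _ {n : ℕ} (E : Fin n → Fin n → Set) where

  TriangleFree : Set
  TriangleFree = ∀ x y z → E x y → E y z → E x z → ⊥

  Connected : Fin n → Fin n → Set
  Connected = Star E

  -- the graph has exactly k (connected) components: the components are in
  -- bijection with Fin k, via a surjective labelling c that identifies
  -- exactly the vertices lying in the same component
  HasComponents : ℕ → Set
  HasComponents k = Σ (Fin n → Fin k) λ c →
    Surjective _≡_ _≡_ c × (∀ x y → (c x ≡ c y) ⇔ Connected x y)

module Submission where

-- Let k be the number of sources. A graph on n vertices with k components has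
-- at least n - k edges. Every edge of C^m(D) is witnessed by a common m-step
-- prey, which is a non-source, and by triangle-freeness each vertex witnesses
-- at most one edge. As there are exactly n - k non-sources, no non-source can
-- be dispensed with as a witness. If u had a second prey w′ ≠ w, then (m ≥ 2,
-- v a source) every m-step walk into w enters it from u, so it can be
-- redirected into w′; hence either w witnesses no edge or w′ witnesses only
-- the edge w witnesses, and in both cases one of them is dispensable.

open import Defs
open import Data.Nat using (ℕ; zero; suc; _+_; _≤_; _<_; _≥_; _≤?_; s≤s; z≤n)
open import Data.Nat.Properties using (<⇒≱; +-suc; +-identityʳ; +-monoʳ-<; m≤n⇒m≤1+n)
open import Data.Fin using (Fin; zero; suc; _≟_)
open import Data.Fin.Properties using (injective⇒≤; suc-injective)
open import Data.List using (List; []; _∷_; length; filter; allFin)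
open import Data.List.Properties using (filter-notAll; length-tabulate)
open import Data.List.Membership.Propositional.Properties using (∈-filter⁺; ∈-allFin)
open import Data.List.Relation.Unary.Any as Any using (Any; here; there)
open import Data.Product as Product using (∃; _×_; _,_; proj₁; proj₂)
open import Data.Sum as Sum using (_⊎_; inj₁; inj₂)
open import Data.Empty using (⊥; ⊥-elim)
open import Function using (Equivalence; _∘′_)
open import Relation.Nullary using (¬_; Dec; yes; no; ¬?)
open import Relation.Nullary.Decidable using (decidable-stable; ¬¬-excluded-middle)
open import Relation.Nullary.Negation using (¬¬-Monad)
open import Relation.Unary using (Decidable)
open import Relation.Unary.Properties using (∁?)
open import Relation.Binary.Definitions using (Symmetric)
open import Relation.Binary.PropositionalEquality using (_≡_; _≢_; ≢-sym; refl; sym; trans; cong; subst)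
open import Relation.Binary.Construct.Closure.ReflexiveTransitive using (Star; ε; _◅_; _◅◅_)
import Relation.Binary.Construct.Closure.ReflexiveTransitive as Star
open import Effect.Monad using (RawMonad)
open import Level using (0ℓ)

open RawMonad (¬¬-Monad {0ℓ}) using (_>>=_; pure)

¬¬-decide-all : ∀ n (P : Fin n → Set) → ¬ ¬ (∀ x → Dec (P x))
¬¬-decide-all zero P = pure λ ()
¬¬-decide-all (suc n) P = do
  p₀ ← ¬¬-excluded-middle
  p₊ ← ¬¬-decide-all n (λ x → P (suc x))
  pure λ { zero → p₀ ; (suc x) → p₊ x }

length-filter+length-filter-∁ : ∀ {A : Set} {P : A → Set} (P? : Decidable P) xs →
  length (filter P? xs) + length (filter (∁? P?) xs) ≡ length xs
length-filter+length-filter-∁ P? [] = refl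
length-filter+length-filter-∁ P? (x ∷ xs) with P? x
... | yes _ = cong suc (length-filter+length-filter-∁ P? xs)
... | no _ = trans (+-suc _ _) (cong suc (length-filter+length-filter-∁ P? xs))

module EdgeCover {n : ℕ} {I : Set} (R : I → Fin n → Fin n → Set) where

  AtMostOneEdge : I → Set
  AtMostOneEdge i = ∀ {x y x′ y′} → R i x y → R i x′ y′ →
    (x′ ≡ x × y′ ≡ y) ⊎ (x′ ≡ y × y′ ≡ x)

  Covered : List I → Fin n → Fin n → Set
  Covered l x y = Any (λ i → R i x y ⊎ R i y x) l

  Covered-sym : ∀ l → Symmetric (Covered l)
  Covered-sym l = Any.map Sum.swap

  Path : List I → Fin n → Fin n → Set
  Path l = Star (Covered l)

  Path-sym : ∀ l → Symmetric (Path l)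
  Path-sym l = Star.reverse (Covered-sym l)

  module _ {i : I} (one : AtMostOneEdge i) {a b : Fin n} (rab : R i a b) where

    edge-ends : ∀ {x y} → R i x y ⊎ R i y x → (x ≡ a × y ≡ b) ⊎ (x ≡ b × y ≡ a)
    edge-ends (inj₁ r) = one rab r
    edge-ends (inj₂ r) = Sum.swap (Sum.map Product.swap Product.swap (one rab r))

    path-avoids-or-meets : ∀ {l x y} → Path (i ∷ l) x y →
      Path l x y ⊎ ((Path l x a ⊎ Path l x b) × (Path l a y ⊎ Path l b y))
    path-avoids-or-meets ε = inj₁ ε
    path-avoids-or-meets (there e ◅ p) with path-avoids-or-meets p
    ... | inj₁ q = inj₁ (e ◅ q)
    ... | inj₂ (xa⊎xb , ay⊎by) = inj₂ (Sum.map (e ◅_) (e ◅_) xa⊎xb , ay⊎by)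
    path-avoids-or-meets (here e ◅ p) with edge-ends e | path-avoids-or-meets p
    ... | inj₁ (refl , _) | inj₂ (_ , ay⊎by) = inj₂ (inj₁ ε , ay⊎by)
    ... | inj₂ (refl , _) | inj₂ (_ , ay⊎by) = inj₂ (inj₂ ε , ay⊎by)
    ... | inj₁ (refl , refl) | inj₁ q = inj₂ (inj₁ ε , inj₂ q)
    ... | inj₂ (refl , refl) | inj₁ q = inj₂ (inj₂ ε , inj₁ q)

  -- The recursion needs excluded middle twice, which is available under ¬¬
  -- and harmless since n ≤ k + length l is decidable.
  ¬¬-vertices≤components+edges : (∀ i → AtMostOneEdge i) → ∀ l k (c : Fin n → Fin k) →
    (∀ x y → c x ≡ c y → Path l x y) → ¬ ¬ (n ≤ k + length l)
  ¬¬-vertices≤components+edges one [] k c conn =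
    pure (subst (n ≤_) (sym (+-identityʳ k)) (injective⇒≤ λ {x} {y} e → trivial (conn x y e)))
    where
    trivial : ∀ {x y} → Path [] x y → x ≡ y
    trivial ε = refl
    trivial (() ◅ _)
  ¬¬-vertices≤components+edges one (i ∷ l) k c conn = ¬¬-excluded-middle >>= λ where
      (no ¬edge) → do
        le ← ¬¬-vertices≤components+edges one l k c λ x y e → Star.map (drop ¬edge) (conn x y e)
        pure (subst (n ≤_) (sym (+-suc k (length l))) (m≤n⇒m≤1+n le))
      (yes (a , b , rab)) → do
        toB? ← ¬¬-decide-all n (λ x → Path l x b)
        le ← ¬¬-vertices≤components+edges one l (suc k) (merge toB?) (merge-conn rab toB?)
        pure (subst (n ≤_) (sym (+-suc k (length l))) le)
    where
    drop : ¬ (∃ λ a → ∃ λ b → R i a b) → ∀ {x y} → Covered (i ∷ l) x y → Covered l x y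
    drop ¬edge (here (inj₁ r)) = ⊥-elim (¬edge (_ , _ , r))
    drop ¬edge (here (inj₂ r)) = ⊥-elim (¬edge (_ , _ , r))
    drop ¬edge (there e) = e

    -- Removing the edge i = {a, b} may split one component: the new component
    -- of b gets the fresh label zero.
    merge : ∀ {b} → (∀ x → Dec (Path l x b)) → Fin n → Fin (suc k)
    merge toB? x with toB? x
    ... | yes _ = zero
    ... | no _ = suc (c x)

    merge-conn : ∀ {a b} → R i a b → (toB? : ∀ x → Dec (Path l x b)) →
      ∀ x y → merge toB? x ≡ merge toB? y → Path l x y
    merge-conn rab toB? x y e with toB? x | toB? y
    ... | yes xb | yes yb = xb ◅◅ Path-sym l yb
    ... | no ¬xb | no ¬yb with path-avoids-or-meets (one i) rab (conn x y (suc-injective e))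
    ...   | inj₁ p = p
    ...   | inj₂ (inj₁ xa , inj₁ ay) = xa ◅◅ ay
    ...   | inj₂ (inj₂ xb , _) = ⊥-elim (¬xb xb)
    ...   | inj₂ (_ , inj₂ by) = ⊥-elim (¬yb (Path-sym l by))

  vertices≤components+edges : (∀ i → AtMostOneEdge i) → ∀ l k (c : Fin n → Fin k) →
    (∀ x y → c x ≡ c y → Path l x y) → n ≤ k + length l
  vertices≤components+edges one l k c conn =
    decidable-stable (n ≤? k + length l) (¬¬-vertices≤components+edges one l k c conn)

module _ {n : ℕ} (D : Digraph n) where

  walk-exists : OutdegreePositive D → ∀ j x → ∃ (Walk D j x)
  walk-exists od zero x = x , refl
  walk-exists od (suc j) x with od x
  ... | y , xy with walk-exists od j y
  ... | z , yz = z , y , xy , yz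

  walk-snoc : ∀ j {x y z} → Walk D j x y → Prey D y z → Walk D (suc j) x z
  walk-snoc zero refl yz = _ , yz , refl
  walk-snoc (suc j) (x′ , xx′ , x′y) yz = x′ , xx′ , walk-snoc j x′y yz

  walk-unsnoc : ∀ j {x z} → Walk D (suc j) x z → ∃ λ y → Walk D j x y × Prey D y z
  walk-unsnoc zero (z , xz , refl) = _ , refl , xz
  walk-unsnoc (suc j) (x′ , xx′ , x′z) with walk-unsnoc j x′z
  ... | y , x′y , yz = y , (x′ , xx′ , x′y) , yz

  prey-nonSource : ∀ {x y} → Prey D x y → ¬ Source D y
  prey-nonSource {x} xy src with trans (sym xy) (src x)
  ... | ()

  walk-end-nonSource : ∀ j {x y} → Walk D (suc j) x y → ¬ Source D y
  walk-end-nonSource j w = prey-nonSource (proj₂ (proj₂ (walk-unsnoc j w)))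

module Competition {n : ℕ} (D : Digraph n) (m : ℕ)
  (triangle-free : TriangleFree (CompEdge D (suc m))) where

  CommonPrey : Fin n → Fin n → Fin n → Set
  CommonPrey z x y = x ≢ y × Walk D (suc m) x z × Walk D (suc m) y z

  CommonPrey-sym : ∀ {z x y} → CommonPrey z x y → CommonPrey z y x
  CommonPrey-sym (x≢y , xz , yz) = ≢-sym x≢y , yz , xz

  no-three-predators : ∀ {a b c z} → a ≢ b → b ≢ c → a ≢ c →
    Walk D (suc m) a z → Walk D (suc m) b z → Walk D (suc m) c z → ⊥
  no-three-predators {a} {b} {c} {z} a≢b b≢c a≢c az bz cz =
    triangle-free a b c (a≢b , z , az , bz) (b≢c , z , bz , cz) (a≢c , z , az , cz)

  open EdgeCover CommonPrey

  commonPrey-atMostOneEdge : ∀ z → AtMostOneEdge z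
  commonPrey-atMostOneEdge z {x} {y} {x′} {y′} (x≢y , xz , yz) (x′≢y′ , x′z , y′z)
    with x′ ≟ x | y′ ≟ y | x′ ≟ y | y′ ≟ x
  ... | yes p | yes q | _ | _ = inj₁ (p , q)
  ... | yes refl | no q | _ | _ = ⊥-elim (no-three-predators x≢y (≢-sym q) x′≢y′ xz yz y′z)
  ... | no _ | _ | yes r | yes s = inj₂ (r , s)
  ... | no _ | _ | yes refl | no s = ⊥-elim (no-three-predators x≢y x′≢y′ (≢-sym s) xz yz y′z)
  ... | no p | _ | no r | _ = ⊥-elim (no-three-predators x≢y (≢-sym r) (≢-sym p) xz yz x′z)

  predators-of-shared-prey : OutdegreePositive D → ∀ {u v w y} → u ≢ v →
    Prey D u w → Prey D v w → Prey D y w → y ≡ u ⊎ y ≡ v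
  predators-of-shared-prey od {u} {v} {w} {y} u≢v uw vw yw with y ≟ u | y ≟ v
  ... | yes y≡u | _ = inj₁ y≡u
  ... | no _ | yes y≡v = inj₂ y≡v
  ... | no y≢u | no y≢v =
    ⊥-elim (no-three-predators u≢v (≢-sym y≢v) (≢-sym y≢u) (w , uw , wz) (w , vw , wz) (w , yw , wz))
    where wz = proj₂ (walk-exists D od m w)

  Dispensable : Fin n → Set
  Dispensable w = ∀ {x y z} → CommonPrey z x y → ∃ λ z′ → z′ ≢ w × CommonPrey z′ x y

  nonSource-indispensable : HasComponents (CompEdge D (suc m)) (numSources D) →
    ∀ {w} → ¬ Source D w → ¬ Dispensable w
  nonSource-indispensable (c , _ , components) {w} nonSrc dispensable =
    <⇒≱ fewer-witnesses (vertices≤components+edges commonPrey-atMostOneEdge witnesses k c connected)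
    where
    k = numSources D
    nonSources = filter (∁? (Source? D)) (allFin n)
    witnesses = filter (λ z → ¬? (z ≟ w)) nonSources

    covered : ∀ {x y} → CompEdge D (suc m) x y → Covered witnesses x y
    covered (x≢y , z , xz , yz) with dispensable (x≢y , xz , yz)
    ... | z′ , z′≢w , common@(_ , xz′ , _) =
      Any.map (λ { refl → inj₁ common })
        (∈-filter⁺ _ (∈-filter⁺ _ (∈-allFin z′) (walk-end-nonSource D m xz′)) z′≢w)

    connected : ∀ x y → c x ≡ c y → Path witnesses x y
    connected x y e = Star.map covered (Equivalence.to (components x y) e)

    fewer-witnesses : k + length witnesses < n
    fewer-witnesses = subst (k + length witnesses <_) k+nonSources≡n
      (+-monoʳ-< k (filter-notAll _ nonSources
        (Any.map (λ { refl w≢w → w≢w refl }) (∈-filter⁺ _ (∈-allFin w) nonSrc))))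
      where
      k+nonSources≡n : k + length nonSources ≡ n
      k+nonSources≡n = trans (length-filter+length-filter-∁ (Source? D) (allFin n))
                             (length-tabulate (λ x → x))

module SourceNeighbour {n : ℕ} (D : Digraph n) (m : ℕ) (od : OutdegreePositive D)
  (triangle-free : TriangleFree (CompEdge D (suc (suc m))))
  (components : HasComponents (CompEdge D (suc (suc m))) (numSources D))
  {u v w : Fin n} (src : Source D v) (u≢v : u ≢ v) (vw : Prey D v w) (uw : Prey D u w) where

  open Competition D (suc m) triangle-free

  -- As m ≥ 2, the last step of an m-step walk into w leaves a non-source,
  -- hence leaves u rather than v.
  reroute : ∀ {x w′} → Prey D u w′ → Walk D (suc (suc m)) x w → Walk D (suc (suc m)) x w′
  reroute uw′ xw with walk-unsnoc D (suc m) xw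
  ... | y , xy , yw with predators-of-shared-prey od u≢v uw vw yw
  ... | inj₁ refl = walk-snoc D (suc m) xy uw′
  ... | inj₂ refl = ⊥-elim (walk-end-nonSource D m xy src)

  edgeless-dispensable : ¬ (∃ λ x → ∃ λ y → CommonPrey w x y) → Dispensable w
  edgeless-dispensable ¬edge {x} {y} {z} common = z , (λ { refl → ¬edge (x , y , common) }) , common

  rerouted-dispensable : ∀ {x y w′} → Prey D u w′ → w′ ≢ w → CommonPrey w x y → Dispensable w′
  rerouted-dispensable {x} {y} {w′} uw′ w′≢w common@(x≢y , xw , yw) {z = z} common′ with z ≟ w′
  ... | no z≢w′ = z , z≢w′ , common′
  ... | yes refl with commonPrey-atMostOneEdge w′ (x≢y , reroute uw′ xw , reroute uw′ yw) common′
  ...   | inj₁ (refl , refl) = w , w′≢w ∘′ sym , common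
  ...   | inj₂ (refl , refl) = w , w′≢w ∘′ sym , CommonPrey-sym common

  prey-unique : ∀ {w′} → Prey D u w′ → w′ ≡ w
  prey-unique {w′} uw′ = decidable-stable (w′ ≟ w) λ w′≢w →
    ¬¬-excluded-middle {A = ∃ λ x → ∃ λ y → CommonPrey w x y} λ where
    (yes (x , y , common)) →
      nonSource-indispensable components (prey-nonSource D uw′) (rerouted-dispensable uw′ w′≢w common)
    (no ¬edge) →
      nonSource-indispensable components (prey-nonSource D vw) (edgeless-dispensable ¬edge)

  competes-with-source : CompEdge D (suc (suc m)) u v
  competes-with-source = u≢v , z , (w , uw , wz) , (w , vw , wz)
    where
    z = proj₁ (walk-exists D od (suc m) w)
    wz = proj₂ (walk-exists D od (suc m) w)

  sole-neighbour : ∀ {x} → CompEdge D (suc (suc m)) u x → x ≡ v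
  sole-neighbour {x} (u≢x , z , (w₁ , uw₁ , w₁z) , xz) with prey-unique uw₁
  ... | refl = decidable-stable (x ≟ v) λ x≢v →
    no-three-predators u≢v (≢-sym x≢v) u≢x (w , uw , w₁z) (w , vw , w₁z) xz

proposition2p5 : (m : ℕ) → m ≥ 2 → (n : ℕ) → (D : Digraph n) →
    OutdegreePositive D →
    WeaklyConnected D →
    TriangleFree (CompEdge D m) →
    HasComponents (CompEdge D m) (numSources D) →
    ∀ (v u : Fin n) → Source D v → u ≢ v →
    (∃ λ w → Prey D v w × Prey D u w) →
    (∃ λ w → Prey D u w × (∀ w′ → Prey D u w′ → w′ ≡ w))
    × (CompEdge D m u v × (∀ x → CompEdge D m u x → x ≡ v))
proposition2p5 (suc (suc m)) (s≤s (s≤s z≤n)) n D od _ triangle-free components v u src u≢v (w , vw , uw) =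
  (w , uw , λ _ → prey-unique) , competes-with-source , λ _ → sole-neighbour
  where open SourceNeighbour D m od triangle-free components src u≢v vw uw
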